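{- Let $L$ be an IL-algebra with largest element $\top$, and let $F$ be an affine filter of $L$. Then the quotient $L/F$ is a residuated lattice; in particular $[1]=[\top]$, so that the monoid unit $[1]$ is the greatest element of $L/F$.
   Context: An IL-algebra is a structure $(L,\cup,\cap,\bot,\to,\ast,1)$ such that $(L,\cup,\cap)$ is a lattice (with order $\leq$) having least element $\bot$; $(L,\ast,1)$ is a commutative monoid with unit $1$; and for all $x,y,z\in L$, $x\ast y\leq z$ if and only if $x\leq y\to z$ (residuation). Every IL-algebra has a largest element $\top=\bot\to\bot$. A filter of $L$ is a non-empty subset $F\subseteq L$ such that: $1\in F$; if $x,y\in F$ then $x\ast y\in F$ and $x\cap y\in F$; if $x\in F$ and $x\leq y$ then $y\in F$. A filter $F$ is affine if $\top\to 1\in F$. For a filter $F$, the relation $x\,\rho\, y$ iff ($x\to y\in F$ and $y\to x\in F$) is a congruence; $[x]$ is the class of $x$ and $L/F=\{[x]:x\in L\}$ carries the operations $[x]\Box[y]=[x\Box y]$ for $\Box\in\{\cup,\cap,\ast,\to\}$, with constants $[\bot]$, $[1]$. A residuated lattice is a structure $(L,\cup,\cap,0,\to,\ast,1)$ where $(L,\cup,\cap,0,1)$ is a bounded lattice with least element $0$ and greatest element $1$, $(L,\ast,1)$ is a commutative monoid, and $x\ast y\leq z$ iff $x\leq y\to z$ for all $x,y,z$. -}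

module Defs where

open import Level using (Level; _⊔_; suc)
open import Data.Product using (_×_; _,_)
open import Relation.Binary.Core using (Rel)
open import Algebra.Core using (Op₂)
open import Algebra.Definitions using (Congruent₂)
open import Algebra.Structures using (IsCommutativeMonoid)
open import Algebra.Lattice.Structures using (IsLattice)

module _ {a ℓ} {A : Set a} (_≈_ : Rel A ℓ) (_∩_ : Op₂ A) where
  LeqOf : A → A → Set ℓ
  LeqOf x y = (x ∩ y) ≈ x

record IsResiduatedLattice {a ℓ} {A : Set a} (_≈_ : Rel A ℓ)
       (_∪_ _∩_ : Op₂ A) (𝟘 : A) (_⇒_ _*_ : Op₂ A) (𝟙 : A) : Set (a ⊔ ℓ) where
  field
    isLattice           : IsLattice _≈_ _∪_ _∩_
    isCommutativeMonoid : IsCommutativeMonoid _≈_ _*_ 𝟙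
    ⇒-cong              : Congruent₂ _≈_ _⇒_
    least               : ∀ x → LeqOf _≈_ _∩_ 𝟘 x
    greatest            : ∀ x → LeqOf _≈_ _∩_ x 𝟙
    residuation₁        : ∀ x y z → LeqOf _≈_ _∩_ (x * y) z → LeqOf _≈_ _∩_ x (y ⇒ z)
    residuation₂        : ∀ x y z → LeqOf _≈_ _∩_ x (y ⇒ z) → LeqOf _≈_ _∩_ (x * y) z

-- IL-algebra (setoid-based): lattice with least element ⊥, commutative monoid
-- (*,1), and residuation.  No assumption that 1 is the top.
record ILAlgebra a ℓ : Set (suc (a ⊔ ℓ)) where
  infixr 5 _⇒_
  field
    Carrier : Set a
    _≈_     : Rel Carrier ℓ
    _∪_     : Op₂ Carrier
    _∩_     : Op₂ Carrier
    ⊥       : Carrier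
    _⇒_     : Op₂ Carrier
    _*_     : Op₂ Carrier
    𝟙       : Carrier
    isLattice           : IsLattice _≈_ _∪_ _∩_
    isCommutativeMonoid : IsCommutativeMonoid _≈_ _*_ 𝟙
    ⇒-cong              : Congruent₂ _≈_ _⇒_
    least               : ∀ x → LeqOf _≈_ _∩_ ⊥ x
    residuation₁        : ∀ x y z → LeqOf _≈_ _∩_ (x * y) z → LeqOf _≈_ _∩_ x (y ⇒ z)
    residuation₂        : ∀ x y z → LeqOf _≈_ _∩_ x (y ⇒ z) → LeqOf _≈_ _∩_ (x * y) z

  _≤_ : Carrier → Carrier → Set ℓ
  _≤_ = LeqOf _≈_ _∩_

  ⊤ : Carrier
  ⊤ = ⊥ ⇒ ⊥

  record IsFilter {f} (F : Carrier → Set f) : Set (a ⊔ ℓ ⊔ f) where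
    field
      one∈    : F 𝟙
      *-closed : ∀ {x y} → F x → F y → F (x * y)
      ∩-closed : ∀ {x y} → F x → F y → F (x ∩ y)
      up-closed : ∀ {x y} → F x → x ≤ y → F y

  record IsAffineFilter {f} (F : Carrier → Set f) : Set (a ⊔ ℓ ⊔ f) where
    field
      isFilter : IsFilter F
      affine   : F (⊤ ⇒ 𝟙)

  -- the congruence ρ determined by F; L/F is L with equality ρ
  ρ : ∀ {f} (F : Carrier → Set f) → Rel Carrier f
  ρ F x y = F (x ⇒ y) × F (y ⇒ x)

-- Write x ≼ y for x ⇒ y ∈ F.  For any filter F this is a preorder compatible
-- with ∪, ∩, * and ⇒ (antitone in the first argument of ⇒), so its symmetric
-- part ρ is a congruence, and the order of L/F is exactly ≼.  Every lattice,
-- monoid and residuation law of L therefore descends to L/F, and [⊥] is least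
-- since ⊥ ≤ x.  The one law that fails in general is that [1] is the top:
-- x ≤ ⊤ gives ⊤ ⇒ 1 ≤ x ⇒ 1, so affinity (⊤ ⇒ 1 ∈ F) yields x ≼ 1.
module Submission where

open import Defs
open import Data.Product using (_×_; _,_; proj₁; proj₂; swap)
open import Algebra.Core using (Op₂)
open import Algebra.Definitions using (Congruent₂)
open import Algebra.Structures using (IsCommutativeMonoid)
open import Algebra.Lattice.Bundles using (Lattice)
open import Algebra.Lattice.Structures using (IsLattice)
import Algebra.Lattice.Properties.Lattice as LatticeProperties
import Relation.Binary.Lattice as OrderTheoretic
open import Relation.Binary.Structures using (IsEquivalence)

module ILAlgebraProperties {a ℓ} (L : ILAlgebra a ℓ) where
  open ILAlgebra L
  open IsLattice isLattice using (sym; trans)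
  open IsCommutativeMonoid isCommutativeMonoid using (comm; assoc; identityˡ; ∙-congʳ)

  lattice : Lattice a ℓ
  lattice = record { isLattice = isLattice }

  -- The library's natural order is x ≈ x ∩ y; ours is x ∩ y ≈ x.
  private
    module Order = OrderTheoretic.Lattice
      (LatticeProperties.∨-∧-orderTheoreticLattice lattice)

  ≤-refl : ∀ {x} → x ≤ x
  ≤-refl = sym Order.refl

  ≤-reflexive : ∀ {x y} → x ≈ y → x ≤ y
  ≤-reflexive x≈y = sym (Order.reflexive x≈y)

  ≤-trans : ∀ {x y z} → x ≤ y → y ≤ z → x ≤ z
  ≤-trans x≤y y≤z = sym (Order.trans (sym x≤y) (sym y≤z))

  x∩y≤x : ∀ x y → (x ∩ y) ≤ x
  x∩y≤x x y = sym (Order.x∧y≤x x y)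

  x∩y≤y : ∀ x y → (x ∩ y) ≤ y
  x∩y≤y x y = sym (Order.x∧y≤y x y)

  ∩-greatest : ∀ {x y z} → x ≤ y → x ≤ z → x ≤ (y ∩ z)
  ∩-greatest x≤y x≤z = sym (Order.∧-greatest (sym x≤y) (sym x≤z))

  x≤x∪y : ∀ x y → x ≤ (x ∪ y)
  x≤x∪y x y = sym (Order.x≤x∨y x y)

  y≤x∪y : ∀ x y → y ≤ (x ∪ y)
  y≤x∪y x y = sym (Order.y≤x∨y x y)

  ∪-least : ∀ {x y z} → x ≤ z → y ≤ z → (x ∪ y) ≤ z
  ∪-least x≤z y≤z = sym (Order.∨-least (sym x≤z) (sym y≤z))

  *-comm-≤ : ∀ {x y z} → (x * y) ≤ z → (y * x) ≤ z
  *-comm-≤ {x} {y} xy≤z = ≤-trans (≤-reflexive (comm y x)) xy≤z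

  ⇒-eval : ∀ x y → ((x ⇒ y) * x) ≤ y
  ⇒-eval x y = residuation₂ (x ⇒ y) x y ≤-refl

  *-monoˡ-≤ : ∀ {x y} z → x ≤ y → (x * z) ≤ (y * z)
  *-monoˡ-≤ {x} {y} z x≤y =
    residuation₂ x z (y * z) (≤-trans x≤y (residuation₁ y z (y * z) ≤-refl))

  *-monoʳ-≤ : ∀ {x y} z → x ≤ y → (z * x) ≤ (z * y)
  *-monoʳ-≤ {x} {y} z x≤y =
    *-comm-≤ (≤-trans (*-monoˡ-≤ z x≤y) (≤-reflexive (comm y z)))

  ⇒-compose : ∀ x y z → ((x ⇒ y) * (y ⇒ z)) ≤ (x ⇒ z)
  ⇒-compose x y z = residuation₁ _ x z
    (≤-trans (≤-reflexive (trans (∙-congʳ (comm _ _)) (assoc _ _ _)))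
      (≤-trans (*-monoʳ-≤ (y ⇒ z) (⇒-eval x y)) (⇒-eval y z)))

  ⇒-antitoneˡ-≤ : ∀ {x y} z → x ≤ y → (y ⇒ z) ≤ (x ⇒ z)
  ⇒-antitoneˡ-≤ {x} {y} z x≤y =
    residuation₁ _ x z (≤-trans (*-monoʳ-≤ (y ⇒ z) x≤y) (⇒-eval y z))

  x≤⊤ : ∀ x → x ≤ ⊤
  x≤⊤ x = residuation₁ x ⊥ ⊥ (*-comm-≤ (residuation₂ ⊥ x ⊥ (least (x ⇒ ⊥))))

  -- In a filter u ∩ 𝟙 lies with u, and multiplying by it can only decrease:
  -- this stands in for the integrality 𝟙 = ⊤ that L lacks.
  ∩𝟙-*-≤ : ∀ u x → ((u ∩ 𝟙) * x) ≤ x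
  ∩𝟙-*-≤ u x = ≤-trans (*-monoˡ-≤ x (x∩y≤y u 𝟙)) (≤-reflexive (identityˡ x))

  ⇒∩𝟙-*-≤ : ∀ x y → (((x ⇒ y) ∩ 𝟙) * x) ≤ y
  ⇒∩𝟙-*-≤ x y = ≤-trans (*-monoˡ-≤ x (x∩y≤x (x ⇒ y) 𝟙)) (⇒-eval x y)

  curry-≤ : ∀ x y z → ((x * y) ⇒ z) ≤ (x ⇒ (y ⇒ z))
  curry-≤ x y z = residuation₁ _ x _ (residuation₁ _ y z
    (≤-trans (≤-reflexive (assoc _ _ _)) (⇒-eval (x * y) z)))

  uncurry-≤ : ∀ x y z → (x ⇒ (y ⇒ z)) ≤ ((x * y) ⇒ z)
  uncurry-≤ x y z = residuation₁ _ _ z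
    (≤-trans (≤-reflexive (sym (assoc _ _ _)))
      (≤-trans (*-monoˡ-≤ y (⇒-eval x (y ⇒ z))) (⇒-eval y z)))

module FilterProperties {a ℓ f} (L : ILAlgebra a ℓ) {F : ILAlgebra.Carrier L → Set f}
                        (isFilter : ILAlgebra.IsFilter L F) where
  open ILAlgebra L
  open ILAlgebra.IsFilter isFilter
  open ILAlgebraProperties L
  open IsLattice isLattice using (∨-comm; ∨-assoc; ∧-comm; ∧-assoc; absorptive)
  open IsCommutativeMonoid isCommutativeMonoid using (comm; assoc; identity; identityˡ)
  module ≈ = IsLattice isLattice

  infix 4 _≼_ _≤ᶠ_

  _≼_ : Carrier → Carrier → Set f
  x ≼ y = F (x ⇒ y)

  _≤ᶠ_ : Carrier → Carrier → Set f
  _≤ᶠ_ = LeqOf (ρ F) _∩_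

  ≤⇒≼ : ∀ {x y} → x ≤ y → x ≼ y
  ≤⇒≼ {x} {y} x≤y =
    up-closed one∈ (residuation₁ 𝟙 x y (≤-trans (≤-reflexive (identityˡ x)) x≤y))

  ≼-trans : ∀ {x y z} → x ≼ y → y ≼ z → x ≼ z
  ≼-trans x≼y y≼z = up-closed (*-closed x≼y y≼z) (⇒-compose _ _ _)

  ≈⇒ρ : ∀ {x y} → x ≈ y → ρ F x y
  ≈⇒ρ x≈y = ≤⇒≼ (≤-reflexive x≈y) , ≤⇒≼ (≤-reflexive (≈.sym x≈y))

  ρ-isEquivalence : IsEquivalence (ρ F)
  ρ-isEquivalence = record
    { refl  = ≈⇒ρ ≈.refl
    ; sym   = swap
    ; trans = λ (x≼y , y≼x) (y≼z , z≼y) → ≼-trans x≼y y≼z , ≼-trans z≼y y≼x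
    }

  ∪-monoˡ-≼ : ∀ {x y} z → x ≼ y → (x ∪ z) ≼ (y ∪ z)
  ∪-monoˡ-≼ {x} {y} z x≼y = up-closed (∩-closed x≼y one∈) (residuation₁ _ _ _
    (*-comm-≤ (residuation₂ _ _ _ (∪-least
      (residuation₁ _ _ _ (*-comm-≤ (≤-trans (⇒∩𝟙-*-≤ x y) (x≤x∪y y z))))
      (residuation₁ _ _ _ (*-comm-≤ (≤-trans (∩𝟙-*-≤ (x ⇒ y) z) (y≤x∪y y z))))))))

  ∩-monoˡ-≼ : ∀ {x y} z → x ≼ y → (x ∩ z) ≼ (y ∩ z)
  ∩-monoˡ-≼ {x} {y} z x≼y = up-closed (∩-closed x≼y one∈) (residuation₁ _ _ _ (∩-greatest
    (≤-trans (*-monoʳ-≤ _ (x∩y≤x x z)) (⇒∩𝟙-*-≤ x y))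
    (≤-trans (∩𝟙-*-≤ (x ⇒ y) (x ∩ z)) (x∩y≤y x z))))

  *-monoˡ-≼ : ∀ {x y} z → x ≼ y → (x * z) ≼ (y * z)
  *-monoˡ-≼ {x} {y} z x≼y = up-closed x≼y (residuation₁ _ _ _
    (≤-trans (≤-reflexive (≈.sym (assoc _ _ _))) (*-monoˡ-≤ z (⇒-eval x y))))

  ⇒-antitoneˡ-≼ : ∀ {x y} z → x ≼ y → (y ⇒ z) ≼ (x ⇒ z)
  ⇒-antitoneˡ-≼ z x≼y = up-closed x≼y (residuation₁ _ _ _ (⇒-compose _ _ _))

  ⇒-monoʳ-≼ : ∀ {x y} z → x ≼ y → (z ⇒ x) ≼ (z ⇒ y)
  ⇒-monoʳ-≼ z x≼y = up-closed x≼y (residuation₁ _ _ _ (*-comm-≤ (⇒-compose _ _ _)))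

  ρ-cong₂ : ∀ (_∙_ : Op₂ Carrier) → (∀ x y → (x ∙ y) ≈ (y ∙ x)) →
            (∀ {x y} z → x ≼ y → (x ∙ z) ≼ (y ∙ z)) → Congruent₂ (ρ F) _∙_
  ρ-cong₂ _∙_ ∙-comm ∙-monoˡ {u = u} (x≼y , y≼x) (u≼v , v≼u) =
    ≼-trans (∙-monoˡ u x≼y) (∙-monoʳ u≼v) , ≼-trans (∙-monoʳ v≼u) (∙-monoˡ u y≼x)
    where
    ∙-monoʳ : ∀ {x y z} → x ≼ y → (z ∙ x) ≼ (z ∙ y)
    ∙-monoʳ {x} {y} {z} x≼y =
      up-closed (∙-monoˡ z x≼y) (≤-reflexive (⇒-cong (∙-comm x z) (∙-comm y z)))

  ρ-⇒-cong : Congruent₂ (ρ F) _⇒_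
  ρ-⇒-cong (x≼y , y≼x) (u≼v , v≼u) =
    ≼-trans (⇒-antitoneˡ-≼ _ y≼x) (⇒-monoʳ-≼ _ u≼v) ,
    ≼-trans (⇒-antitoneˡ-≼ _ x≼y) (⇒-monoʳ-≼ _ v≼u)

  ≼⇒≤ᶠ : ∀ {x y} → x ≼ y → x ≤ᶠ y
  ≼⇒≤ᶠ {x} {y} x≼y = ≤⇒≼ (x∩y≤x x y) ,
    up-closed (∩-closed x≼y one∈)
      (residuation₁ _ _ _ (∩-greatest (∩𝟙-*-≤ (x ⇒ y) x) (⇒∩𝟙-*-≤ x y)))

  ≤ᶠ⇒≼ : ∀ {x y} → x ≤ᶠ y → x ≼ y
  ≤ᶠ⇒≼ {x} {y} (_ , x≼x∩y) = ≼-trans x≼x∩y (≤⇒≼ (x∩y≤y x y))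

  quotientIsLattice : IsLattice (ρ F) _∪_ _∩_
  quotientIsLattice = record
    { isEquivalence = ρ-isEquivalence
    ; ∨-comm        = λ x y → ≈⇒ρ (∨-comm x y)
    ; ∨-assoc       = λ x y z → ≈⇒ρ (∨-assoc x y z)
    ; ∨-cong        = ρ-cong₂ _∪_ ∨-comm ∪-monoˡ-≼
    ; ∧-comm        = λ x y → ≈⇒ρ (∧-comm x y)
    ; ∧-assoc       = λ x y z → ≈⇒ρ (∧-assoc x y z)
    ; ∧-cong        = ρ-cong₂ _∩_ ∧-comm ∩-monoˡ-≼
    ; absorptive    = (λ x y → ≈⇒ρ (proj₁ absorptive x y))
                    , (λ x y → ≈⇒ρ (proj₂ absorptive x y))
    }

  quotientIsCommutativeMonoid : IsCommutativeMonoid (ρ F) _*_ 𝟙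
  quotientIsCommutativeMonoid = record
    { isMonoid = record
      { isSemigroup = record
        { isMagma = record
          { isEquivalence = ρ-isEquivalence
          ; ∙-cong        = ρ-cong₂ _*_ comm *-monoˡ-≼
          }
        ; assoc = λ x y z → ≈⇒ρ (assoc x y z)
        }
      ; identity = (λ x → ≈⇒ρ (proj₁ identity x))
                 , (λ x → ≈⇒ρ (proj₂ identity x))
      }
    ; comm = λ x y → ≈⇒ρ (comm x y)
    }

  quotient-residuation₁ : ∀ x y z → (x * y) ≤ᶠ z → x ≤ᶠ (y ⇒ z)
  quotient-residuation₁ x y z xy≤ᶠz = ≼⇒≤ᶠ (up-closed (≤ᶠ⇒≼ xy≤ᶠz) (curry-≤ x y z))

  quotient-residuation₂ : ∀ x y z → x ≤ᶠ (y ⇒ z) → (x * y) ≤ᶠ z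
  quotient-residuation₂ x y z x≤ᶠy⇒z = ≼⇒≤ᶠ (up-closed (≤ᶠ⇒≼ x≤ᶠy⇒z) (uncurry-≤ x y z))

mainTheorem12 : ∀ {a ℓ f} (L : ILAlgebra a ℓ) (F : ILAlgebra.Carrier L → Set f) →
    ILAlgebra.IsAffineFilter L F →
    IsResiduatedLattice (ILAlgebra.ρ L F) (ILAlgebra._∪_ L) (ILAlgebra._∩_ L)
    (ILAlgebra.⊥ L) (ILAlgebra._⇒_ L) (ILAlgebra._*_ L) (ILAlgebra.𝟙 L)
    × ILAlgebra.ρ L F (ILAlgebra.𝟙 L) (ILAlgebra.⊤ L)
mainTheorem12 L F affineFilter = isResiduatedLattice , (≤⇒≼ (x≤⊤ 𝟙) , affine)
  where
  open ILAlgebra L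
  open IsAffineFilter affineFilter
  open IsFilter isFilter using (up-closed)
  open ILAlgebraProperties L
  open FilterProperties L isFilter

  isResiduatedLattice : IsResiduatedLattice (ρ F) _∪_ _∩_ ⊥ _⇒_ _*_ 𝟙
  isResiduatedLattice = record
    { isLattice           = quotientIsLattice
    ; isCommutativeMonoid = quotientIsCommutativeMonoid
    ; ⇒-cong              = ρ-⇒-cong
    ; least               = λ x → ≼⇒≤ᶠ (≤⇒≼ (least x))
    ; greatest            = λ x → ≼⇒≤ᶠ (up-closed affine (⇒-antitoneˡ-≤ 𝟙 (x≤⊤ x)))
    ; residuation₁        = quotient-residuation₁
    ; residuation₂        = quotient-residuation₂
    }
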